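{- Let $k$ be a positive integer and let $D$ be a digraph with a partition $\{X,Y\}$ of $V(D)$ such that $D[X]$ is traceable and $Y$ is a stable set of $D$. If $\lambda(D)>|X|$, then $\pi_k(D)\leq\alpha_k(D)$.
   Context: Digraphs have no loops and no parallel arcs. Paths are directed paths; the size $|P|$ of a path is its number of vertices, and $\lambda(D)$ is the maximum size of a path in $D$. A digraph is traceable if it has a Hamiltonian path. A stable set of $D$ is a stable set of its underlying undirected graph. A path partition of $D$ is a set of vertex-disjoint paths covering $V(D)$; its $k$-norm is $\sum_P\min\{|P|,k\}$, and $\pi_k(D)$ is the minimum $k$-norm of a path partition of $D$. A $k$-partial coloring is a set of $k$ pairwise disjoint stable sets (empty allowed); its weight is the sum of their sizes, and $\alpha_k(D)$ is the maximum weight of a $k$-partial coloring of $D$. -}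

module Defs where

open import Data.Nat using (ℕ; _⊓_; _+_)
open import Data.Nat.ListAction using (sum)
open import Data.Fin using (Fin)
open import Data.Bool using (Bool; true; false)
open import Data.List using (List; []; length; map; concat; allFin; filterᵇ)
open import Data.List.Relation.Unary.All using (All)
open import Data.List.Relation.Unary.Unique.Propositional using (Unique)
open import Data.List.Relation.Unary.Linked using (Linked)
open import Data.List.Membership.Propositional using (_∈_)
open import Data.Vec using (Vec; toList)
open import Data.Product using (_×_; ∃)
open import Relation.Binary.PropositionalEquality using (_≡_; _≢_)
open import Function.Bundles using (_⇔_)

-- A digraph on vertex set Fin n: arc u v = true iff there is an arc u → v.
-- A Bool-valued relation automatically excludes parallel arcs; loops are excluded explicitly.
record Digraph (n : ℕ) : Set where
  field
    arc      : Fin n → Fin n → Bool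
    loopless : ∀ v → arc v v ≡ false
open Digraph public

module _ {n : ℕ} (D : Digraph n) where

  Arc : Fin n → Fin n → Set
  Arc u v = arc D u v ≡ true

  -- A directed path: a list of pairwise distinct vertices with consecutive arcs.
  -- Its size |P| is its length (number of vertices).
  IsPath : List (Fin n) → Set
  IsPath P = Unique P × Linked Arc P

  IsStable : List (Fin n) → Set
  IsStable S = Unique S × (∀ u v → u ∈ S → v ∈ S → arc D u v ≡ false)

  IsPathPartition : List (List (Fin n)) → Set
  IsPathPartition Ps =
    All (λ P → IsPath P × P ≢ []) Ps × Unique (concat Ps) × (∀ v → v ∈ concat Ps)

  IsPartialColoring : (k : ℕ) → Vec (List (Fin n)) k → Set
  IsPartialColoring k C = All IsStable (toList C) × Unique (concat (toList C))

  -- D[X] is traceable (X given as a Boolean predicate): some path of D has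
  -- exactly the vertices of X.
  InducedTraceable : (Fin n → Bool) → Set
  InducedTraceable inX = ∃ λ P → IsPath P × (∀ v → (v ∈ P) ⇔ (inX v ≡ true))

kNorm : {n : ℕ} → ℕ → List (List (Fin n)) → ℕ
kNorm k Ps = sum (map (λ P → length P ⊓ k) Ps)

weight : {n k : ℕ} → Vec (List (Fin n)) k → ℕ
weight C = sum (map length (toList C))

card : {n : ℕ} → (Fin n → Bool) → ℕ
card {n} inX = length (filterᵇ inX (allFin n))

-- A path Q with |Q| > |X|, completed
-- by singleton paths, is a path partition of k-norm min(|Q|,k) + (n − |Q|); the
-- stable set Y together with k − 1 singletons from X is a k-partial colouring of
-- weight (n − |X|) + min(k − 1,|X|).  As min(·,k) is 1-Lipschitz,
-- min(|Q|,k) ≤ min(|X| + 1,k) + (|Q| − |X| − 1) = min(k − 1,|X|) + (|Q| − |X|).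
module Submission where

open import Defs
open import Data.Nat using (ℕ; zero; suc; _+_; _⊓_; _≤_; _<_; z≤n; NonZero)
open import Data.Nat.Properties
  using (≤-trans; ≤-reflexive; +-comm; +-assoc; +-suc; +-monoˡ-≤; +-monoʳ-≤; +-cancelˡ-≤;
         m≤m+n; n≮0; ⊓-comm; ⊓-monoʳ-≤; +-distribʳ-⊓; m≥n⇒m⊓n≡n; m≤n⇒∃[o]m+o≡n;
         module ≤-Reasoning)
open import Data.Nat.ListAction using (sum)
open import Data.Bool using (Bool; true; false; not; T; T?)
open import Data.Bool.Properties using (T-not-≡)
open import Data.Empty using (⊥-elim)
open import Data.Fin using (Fin; zero; suc)
open import Data.Fin.Properties using (_≟_; injective⇒≤)
open import Data.List
  using (List; []; _∷_; [_]; _++_; length; map; concat; filter; filterᵇ; allFin; lookup; take)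
open import Data.List.Properties using (concat-map-[_]; take++drop≡id; take-[]; length-++; length-tabulate)
open import Data.List.Relation.Unary.All using (All; []; _∷_)
import Data.List.Relation.Unary.All as All
open import Data.List.Relation.Unary.All.Properties using (map⁺)
open import Data.List.Relation.Unary.Any using (here)
open import Data.List.Relation.Unary.Linked using ([-])
open import Data.List.Relation.Unary.AllPairs using ([]; _∷_)
open import Data.List.Relation.Unary.Unique.Propositional using (Unique)
open import Data.List.Relation.Unary.Unique.Propositional.Properties using (++⁺; filter⁺; take⁺; allFin⁺)
open import Data.List.Membership.Propositional using (_∈_)
open import Data.List.Membership.Propositional.Properties
  using (∈-lookup; ∈-++⁺ˡ; ∈-++⁺ʳ; ∈-filter⁺; ∈-filter⁻; ∈-allFin)
open import Data.Vec using (Vec; toList) renaming ([] to []ᵥ; _∷_ to _∷ᵥ_)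
open import Data.Product using (_×_; ∃; _,_; proj₁; proj₂)
open import Function using (_∘_)
open import Function.Bundles using (Equivalence)
open import Relation.Nullary using (¬_; yes; no)
open import Relation.Binary.PropositionalEquality using (_≡_; _≢_; refl; sym; trans; cong; subst)

lookup-injective : ∀ {A : Set} {xs : List A} {i j} → Unique xs → lookup xs i ≡ lookup xs j → i ≡ j
lookup-injective {i = zero}  {zero}  (_ ∷ _)    _  = refl
lookup-injective {i = zero}  {suc j} (x∉ ∷ _)   eq = ⊥-elim (All.lookup x∉ (∈-lookup j) eq)
lookup-injective {i = suc i} {zero}  (x∉ ∷ _)   eq = ⊥-elim (All.lookup x∉ (∈-lookup i) (sym eq))
lookup-injective {i = suc i} {suc j} (_ ∷ uniq) eq = cong suc (lookup-injective uniq eq)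

Unique⇒length≤ : ∀ {n} {xs : List (Fin n)} → Unique xs → length xs ≤ n
Unique⇒length≤ uniq = injective⇒≤ (lookup-injective uniq)

length-filterᵇ-+-complement : ∀ {A : Set} (p : A → Bool) xs →
  length (filterᵇ p xs) + length (filterᵇ (not ∘ p) xs) ≡ length xs
length-filterᵇ-+-complement p [] = refl
length-filterᵇ-+-complement p (x ∷ xs) with p x
... | true  = cong suc (length-filterᵇ-+-complement p xs)
... | false = trans (+-suc _ _) (cong suc (length-filterᵇ-+-complement p xs))

length-filterᵇ-allFin : ∀ {n} (p : Fin n → Bool) →
  length (filterᵇ p (allFin n)) + length (filterᵇ (not ∘ p) (allFin n)) ≡ n
length-filterᵇ-allFin {n} p = trans (length-filterᵇ-+-complement p (allFin n)) (length-tabulate (λ i → i))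

singletons : ∀ {A : Set} j → List A → Vec (List A) j
singletons zero    _        = []ᵥ
singletons (suc j) []       = [] ∷ᵥ singletons j []
singletons (suc j) (x ∷ xs) = [ x ] ∷ᵥ singletons j xs

concat-singletons : ∀ {A : Set} j (xs : List A) → concat (toList (singletons j xs)) ≡ take j xs
concat-singletons zero    xs       = refl
concat-singletons (suc j) []       = trans (concat-singletons j []) (take-[] j)
concat-singletons (suc j) (x ∷ xs) = cong (x ∷_) (concat-singletons j xs)

∈-singletons⇒∈ : ∀ {A : Set} {v : A} j xs → v ∈ concat (toList (singletons j xs)) → v ∈ xs
∈-singletons⇒∈ j xs v∈ =
  subst (_ ∈_) (take++drop≡id j xs) (∈-++⁺ˡ (subst (_ ∈_) (concat-singletons j xs) v∈))

sum-length-singletons : ∀ {A : Set} j (xs : List A) →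
  sum (map length (toList (singletons j xs))) ≡ j ⊓ length xs
sum-length-singletons zero    xs       = refl
sum-length-singletons (suc j) []       = trans (sum-length-singletons j []) (m≥n⇒m⊓n≡n z≤n)
sum-length-singletons (suc j) (x ∷ xs) = cong suc (sum-length-singletons j xs)

kNorm-singletons : ∀ {n} k (xs : List (Fin n)) → kNorm (suc k) (map [_] xs) ≡ length xs
kNorm-singletons k []       = refl
kNorm-singletons k (x ∷ xs) = cong suc (kNorm-singletons k xs)

q⊓[1+k]+r≤y+k⊓x : ∀ k {q r x y} → x < q → q + r ≤ x + y → q ⊓ suc k + r ≤ y + k ⊓ x
q⊓[1+k]+r≤y+k⊓x k {r = r} {x} {y} x<q q+r≤x+y with m≤n⇒∃[o]m+o≡n x<q
... | d , refl = begin
  (suc x + d) ⊓ suc k + r         ≤⟨ +-monoˡ-≤ r (⊓-monoʳ-≤ (suc x + d) (m≤m+n (suc k) d)) ⟩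
  (suc x + d) ⊓ (suc k + d) + r   ≡⟨ cong (_+ r) (sym (+-distribʳ-⊓ d (suc x) (suc k))) ⟩
  suc (x ⊓ k) + d + r             ≡⟨ +-assoc (suc (x ⊓ k)) d r ⟩
  suc (x ⊓ k + (d + r))           ≡⟨ sym (+-suc (x ⊓ k) (d + r)) ⟩
  x ⊓ k + suc (d + r)             ≤⟨ +-monoʳ-≤ (x ⊓ k) slack ⟩
  x ⊓ k + y                       ≡⟨ cong (_+ y) (⊓-comm x k) ⟩
  k ⊓ x + y                       ≡⟨ +-comm (k ⊓ x) y ⟩
  y + k ⊓ x                       ∎
  where
  open ≤-Reasoning
  slack : suc (d + r) ≤ y
  slack = +-cancelˡ-≤ x _ _
    (subst (_≤ x + y) (trans (+-assoc (suc x) d r) (sym (+-suc x (d + r)))) q+r≤x+y)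

module _ {n : ℕ} (D : Digraph n) where
  open import Data.List.Membership.DecPropositional (_≟_ {n}) using (_∈?_; _∉?_)

  singleton-isPath : ∀ v → IsPath D [ v ] × [ v ] ≢ []
  singleton-isPath v = (([] ∷ []) , [-]) , λ ()

  singleton-isStable : ∀ v → IsStable D [ v ]
  singleton-isStable v = [] ∷ [] , λ { u _ (here refl) (here refl) → loopless D u }

  singletons-isStable : ∀ j xs → All (IsStable D) (toList (singletons j xs))
  singletons-isStable zero    xs       = []
  singletons-isStable (suc j) []       = ([] , λ _ _ ()) ∷ singletons-isStable j []
  singletons-isStable (suc j) (x ∷ xs) = singleton-isStable x ∷ singletons-isStable j xs

  outside : List (Fin n) → List (Fin n)
  outside Q = filter (_∉? Q) (allFin n)

  Unique-++-outside : ∀ {Q} → Unique Q → Unique (Q ++ outside Q)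
  Unique-++-outside uQ = ++⁺ uQ (filter⁺ (_∉? _) (allFin⁺ n))
    (λ (v∈Q , v∈out) → proj₂ (∈-filter⁻ (_∉? _) {xs = allFin n} v∈out) v∈Q)

  path+singletons-isPathPartition : ∀ {Q} → IsPath D Q → Q ≢ [] →
    IsPathPartition D (Q ∷ map [_] (outside Q))
  path+singletons-isPathPartition {Q} Q-path Q≢[] =
    (Q-path , Q≢[]) ∷ map⁺ (All.universal singleton-isPath (outside Q)) ,
    subst (λ R → Unique (Q ++ R)) (sym (concat-map-[ outside Q ])) (Unique-++-outside (proj₁ Q-path)) ,
    covers
    where
    covers : ∀ v → v ∈ Q ++ concat (map [_] (outside Q))
    covers v with v ∈? Q
    ... | yes v∈Q = ∈-++⁺ˡ v∈Q
    ... | no  v∉Q = ∈-++⁺ʳ Q (subst (v ∈_) (sym (concat-map-[ outside Q ]))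
                              (∈-filter⁺ (_∉? Q) (∈-allFin v) v∉Q))

  length-++-outside≤ : ∀ {Q} → Unique Q → length Q + length (outside Q) ≤ n
  length-++-outside≤ {Q} uQ =
    subst (_≤ n) (length-++ Q) (Unique⇒length≤ (Unique-++-outside uQ))

  module _ (inX : Fin n → Bool) where

    Xs Ys : List (Fin n)
    Xs = filterᵇ inX (allFin n)
    Ys = filterᵇ (not ∘ inX) (allFin n)

    stable+singletons : ∀ k → Vec (List (Fin n)) (suc k)
    stable+singletons k = Ys ∷ᵥ singletons k Xs

    stable+singletons-isPartialColoring : ∀ k →
      (∀ u v → inX u ≡ false → inX v ≡ false → arc D u v ≡ false) →
      IsPartialColoring D (suc k) (stable+singletons k)
    stable+singletons-isPartialColoring k Y-stable =
      ((uYs , λ u v u∈Ys v∈Ys → Y-stable u v (∈Ys⇒outside u∈Ys) (∈Ys⇒outside v∈Ys))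
        ∷ singletons-isStable k Xs) ,
      ++⁺ uYs (subst Unique (sym (concat-singletons k Xs)) (take⁺ k uXs)) disjoint
      where
      uXs : Unique Xs
      uXs = filter⁺ _ (allFin⁺ n)
      uYs : Unique Ys
      uYs = filter⁺ _ (allFin⁺ n)
      ∈Ys⇒outside : ∀ {v} → v ∈ Ys → inX v ≡ false
      ∈Ys⇒outside v∈Ys = Equivalence.to T-not-≡ (proj₂ (∈-filter⁻ (T? ∘ not ∘ inX) {xs = allFin n} v∈Ys))
      ∈Xs⇒inside : ∀ {v} → v ∈ Xs → T (inX v)
      ∈Xs⇒inside v∈Xs = proj₂ (∈-filter⁻ (T? ∘ inX) {xs = allFin n} v∈Xs)
      disjoint : ∀ {v} → ¬ (v ∈ Ys × v ∈ concat (toList (singletons k Xs)))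
      disjoint (v∈Ys , v∈C) = subst T (∈Ys⇒outside v∈Ys) (∈Xs⇒inside (∈-singletons⇒∈ k Xs v∈C))

    weight-stable+singletons : ∀ k → weight (stable+singletons k) ≡ length Ys + k ⊓ card inX
    weight-stable+singletons k = cong (length Ys +_) (sum-length-singletons k Xs)

lemma4 : (k : ℕ) → .{{_ : NonZero k}} → (n : ℕ) → (D : Digraph n) → (inX : Fin n → Bool)
    → InducedTraceable D inX
    → (∀ u v → inX u ≡ false → inX v ≡ false → arc D u v ≡ false)
    → (∃ λ P → IsPath D P × card inX < length P)
    → ∃ λ (Ps : List (List (Fin n))) → ∃ λ (C : Vec (List (Fin n)) k)
    → IsPathPartition D Ps × IsPartialColoring D k C × kNorm k Ps ≤ weight C
lemma4 (suc k) n D inX _ Y-stable (Q , Q-path , |X|<|Q|) =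
  Q ∷ map [_] (outside D Q) , stable+singletons D inX k ,
  path+singletons-isPathPartition D Q-path Q≢[] ,
  stable+singletons-isPartialColoring D inX k Y-stable ,
  norm≤weight
  where
  Q≢[] : Q ≢ []
  Q≢[] Q≡[] = n≮0 (subst (λ P → card inX < length P) Q≡[] |X|<|Q|)

  Q+outside≤X+Y : length Q + length (outside D Q) ≤ card inX + length (Ys D inX)
  Q+outside≤X+Y = ≤-trans (length-++-outside≤ D (proj₁ Q-path)) (≤-reflexive (sym (length-filterᵇ-allFin inX)))

  norm≤weight : kNorm (suc k) (Q ∷ map [_] (outside D Q)) ≤ weight (stable+singletons D inX k)
  norm≤weight = begin
    kNorm (suc k) (Q ∷ map [_] (outside D Q))      ≡⟨ cong (length Q ⊓ suc k +_) (kNorm-singletons k (outside D Q)) ⟩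
    length Q ⊓ suc k + length (outside D Q)        ≤⟨ q⊓[1+k]+r≤y+k⊓x k |X|<|Q| Q+outside≤X+Y ⟩
    length (Ys D inX) + k ⊓ card inX               ≡⟨ sym (weight-stable+singletons D inX k) ⟩
    weight (stable+singletons D inX k)             ∎
    where open ≤-Reasoning
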